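{- Let $H=(\mathcal{V},\mathcal{I})$ be an interval hypergraph and $k\ge1$ an integer. There exists a partition of $\mathcal{I}$ into $k$ parts such that each part is an exactly hittable set if and only if there exists a conflict-free colouring of $H$ with $k$ non-zero colours.
   Context: For $n\ge1$, an interval of $[n]=\{1,\dots,n\}$ is a set $\{i,\dots,j\}$ with $1\le i\le j\le n$. An interval hypergraph is $H=(\mathcal{V},\mathcal{I})$ with $\mathcal{V}=[n]$ and $\mathcal{I}$ a set of intervals of $[n]$. A family $\mathcal{S}$ of subsets of $\mathcal{V}$ is exactly hittable if there is $T\subseteq\mathcal{V}$ (an exact hitting set) with $|T\cap S|=1$ for every $S\in\mathcal{S}$. A conflict-free colouring of $H$ is a function $C:\mathcal{V}\to\{0,1,2,\dots\}$ such that for every $I\in\mathcal{I}$ there is a colour $j\ge1$ with $|I\cap C^{ -1}(j)|=1$; its non-zero colours are the values $\ge1$ it uses. -}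

module Defs where

open import Data.Nat using (ℕ; suc)
open import Data.Bool using (Bool; _∧_)
open import Data.Fin using (Fin; _≤_; _≤?_; suc; _≟_)
open import Relation.Nullary.Decidable using (⌊_⌋)
open import Data.Fin.Subset using (Subset; _∩_; ∣_∣)
open import Data.Vec using (tabulate)
open import Data.List using (List; length; lookup)
open import Data.Product using (Σ; ∃; ∃-syntax; _×_)
open import Relation.Binary.PropositionalEquality using (_≡_)

-- Vertex set [n] is represented by Fin n (vertex v ∈ Fin n stands for toℕ v + 1).
-- An interval {i,…,j} with i ≤ j, given by its endpoints.
record Interval (n : ℕ) : Set where
  constructor [_,_]⟨_⟩
  field
    lo : Fin n
    hi : Fin n
    lo≤hi : lo ≤ hi

toSubset : ∀ {n} → Interval n → Subset n
toSubset {n} I = tabulate (λ x → ⌊ Interval.lo I ≤? x ⌋ ∧ ⌊ x ≤? Interval.hi I ⌋)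

hitsExactlyOnce : ∀ {n} → Subset n → Subset n → Set
hitsExactlyOnce T S = ∣ T ∩ S ∣ ≡ 1

-- A partition of the interval family 𝓘 (a list, indexed by Fin (length 𝓘))
-- into k (possibly empty) parts: part c is { 𝓘[i] | p i ≡ c }.
-- Each part is exactly hittable.
PartitionIntoExactlyHittable : ∀ {n} (𝓘 : List (Interval n)) (k : ℕ) → Set
PartitionIntoExactlyHittable {n} 𝓘 k =
  Σ (Fin (length 𝓘) → Fin k) λ p →
    (c : Fin k) → ∃[ T ] ((i : Fin (length 𝓘)) → p i ≡ c →
      hitsExactlyOnce T (toSubset (lookup 𝓘 i)))

colourClass : ∀ {n m} → (Fin n → Fin m) → Fin m → Subset n
colourClass C c = tabulate (λ x → ⌊ C x ≟ c ⌋)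

-- A colouring with colours {0,1,…,k} (Fin (suc k); colour 0 is Fin.zero,
-- non-zero colour j+1 is Fin.suc j) is conflict-free if every interval
-- contains exactly one vertex of some non-zero colour.
ConflictFree : ∀ {n} (𝓘 : List (Interval n)) (k : ℕ) → (Fin n → Fin (suc k)) → Set
ConflictFree 𝓘 k C =
  (i : Fin (length 𝓘)) → ∃[ j ] hitsExactlyOnce (colourClass C (suc j)) (toSubset (lookup 𝓘 i))

module Submission where

-- (⇐) is immediate: part j consists of the intervals whose uniquely coloured vertex has
-- colour j, and the colour class of j hits each of them exactly once.
--
-- (⇒) Let T₁ … T_k be exact hitting sets of the parts.  Colouring each vertex by "the" set
-- containing it works as soon as the Tⱼ are pairwise disjoint, so we make them disjoint
-- without losing the hitting property.  The key step (module RunColouring) takes two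
-- vertex sets A, B and 2-colours A ∪ B by scanning left to right, keeping the colour while
-- the type of the point (in A only, in B only, in both) is unchanged and switching it when
-- the type changes.  If an interval meets A exactly once, all other points of A ∪ B in it
-- are of type "B only", so that point is the only one of its colour there; likewise for B.
-- Replacing A, B by the two colour classes therefore keeps every interval exactly hit and
-- strictly decreases Σⱼ |Tⱼ| whenever A ∩ B ≠ ∅, so iterating this (well-founded recursion
-- on Σⱼ |Tⱼ|, module Disjointify) yields disjoint sets.

open import Defs
open import Data.Nat using (ℕ; zero; suc; _+_; _≤_; _<_; _≥_; _≤′_; ≤′-refl; ≤′-step; z≤n; s≤s; _<?_)
open import Data.Nat.Properties
  using (≤-refl; +-assoc; ≤-trans; <⇒≤; <⇒≢; ≤-<-trans; <-cmp; ≤⇒≤′; ≤′⇒≤; m<n⇒m<1+n;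
         +-mono-≤; +-mono-<-≤; +-mono-≤-<; +-monoʳ-<; +-cancelʳ-<; suc-injective;
         +-0-commutativeMonoid)
open import Data.Nat.Induction using (<-wellFounded)
open import Data.Nat.Tactic.RingSolver using (solve-∀)
open import Data.Bool using (Bool; true; false; _∧_; _∨_; not; if_then_else_)
import Data.Bool as Bool
open import Data.Bool.Properties using (¬-not; not-¬; ∨-identityʳ; ∨-zeroʳ)
open import Data.Fin using (Fin; zero; suc; toℕ; fromℕ<; _≤?_)
import Data.Fin as Fin
import Data.Fin.Properties as Finₚ
open import Data.Fin.Properties using (toℕ<n; toℕ-fromℕ<; fromℕ<-toℕ; toℕ-injective; any?)
open import Data.Fin.Subset using (Subset; _∩_; ∣_∣; inside; outside)
open import Data.Vec using ([]; _∷_; lookup)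
open import Data.Vec.Properties using (lookup-zipWith; lookup∘tabulate)
open import Data.Vec.Functional using (updateAt)
open import Data.Vec.Functional.Properties using (updateAt-updates; updateAt-minimal)
open import Data.List using (List; length)
import Data.List as List
open import Data.List.Relation.Unary.Unique.Propositional using (Unique)
open import Data.Product using (Σ; ∃-syntax; _×_; _,_; proj₁; proj₂)
open import Data.Product.Properties using (≡-dec)
open import Data.Sum using (_⊎_; inj₁; inj₂)
open import Function using (_∘_; const)
open import Induction.WellFounded using (Acc; acc)
open import Relation.Binary.Definitions using (DecidableEquality; Tri; tri<; tri≈; tri>)
open import Relation.Binary.PropositionalEquality
open import Relation.Nullary using (Dec; yes; no; does; ¬_; contradiction)
open import Relation.Nullary.Decidable using (⌊_⌋; isYes≗does; dec-true; dec-false; ¬?; _×-dec_)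
open import Algebra.Properties.CommutativeMonoid.Sum +-0-commutativeMonoid
  using (sum; sum-cong-≗; ∑-distrib-+)

𝟙 : Bool → ℕ
𝟙 true = 1
𝟙 false = 0

𝟙-∨ : ∀ x y → 𝟙 (x ∨ y) ≤ 𝟙 x + 𝟙 y
𝟙-∨ true  _     = s≤s z≤n
𝟙-∨ false true  = s≤s z≤n
𝟙-∨ false false = z≤n

∧-true⁻ : ∀ {x y} → x ∧ y ≡ true → x ≡ true × y ≡ true
∧-true⁻ {true} {true} _ = refl , refl

⌊⌋-true : ∀ {P : Set} (P? : Dec P) → P → ⌊ P? ⌋ ≡ true
⌊⌋-true P? p = trans (isYes≗does P?) (dec-true P? p)

⌊⌋-true⁻ : ∀ {P : Set} (P? : Dec P) → ⌊ P? ⌋ ≡ true → P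
⌊⌋-true⁻ (yes p) _ = p

⌊⌋-false : ∀ {P : Set} (P? : Dec P) → ¬ P → ⌊ P? ⌋ ≡ false
⌊⌋-false P? ¬p = trans (isYes≗does P?) (dec-false P? ¬p)

sum-mono-≤ : ∀ {k} {f g : Fin k → ℕ} → (∀ x → f x ≤ g x) → sum f ≤ sum g
sum-mono-≤ {zero}  _   = z≤n
sum-mono-≤ {suc k} f≤g = +-mono-≤ (f≤g zero) (sum-mono-≤ (f≤g ∘ suc))

sum-mono-< : ∀ {k} {f g : Fin k → ℕ} → (∀ x → f x ≤ g x) →
  (x : Fin k) → f x < g x → sum f < sum g
sum-mono-< f≤g zero    fx<gx = +-mono-<-≤ fx<gx (sum-mono-≤ (f≤g ∘ suc))
sum-mono-< f≤g (suc x) fx<gx = +-mono-≤-< (f≤g zero) (sum-mono-< (f≤g ∘ suc) x fx<gx)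

sum-update : ∀ {k} {f g : Fin k → ℕ} (i : Fin k) → (∀ x → x ≢ i → g x ≡ f x) →
  sum g + f i ≡ sum f + g i
sum-update {f = f} {g} zero agree = begin
  g zero + sum (g ∘ suc) + f zero  ≡⟨ cong (λ s → g zero + s + f zero) tails ⟩
  g zero + sum (f ∘ suc) + f zero  ≡⟨ swap-outer (g zero) (sum (f ∘ suc)) (f zero) ⟩
  f zero + sum (f ∘ suc) + g zero  ∎
  where
  open ≡-Reasoning
  tails : sum (g ∘ suc) ≡ sum (f ∘ suc)
  tails = sum-cong-≗ (λ x → agree (suc x) λ ())
  swap-outer : ∀ a s b → a + s + b ≡ b + s + a
  swap-outer = solve-∀
sum-update {f = f} {g} (suc i) agree = begin
  g zero + sum (g ∘ suc) + f (suc i)    ≡⟨ +-assoc (g zero) _ _ ⟩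
  g zero + (sum (g ∘ suc) + f (suc i))  ≡⟨ cong₂ _+_ (agree zero λ ()) tails ⟩
  f zero + (sum (f ∘ suc) + g (suc i))  ≡⟨ +-assoc (f zero) _ _ ⟨
  f zero + sum (f ∘ suc) + g (suc i)    ∎
  where
  open ≡-Reasoning
  tails : sum (g ∘ suc) + f (suc i) ≡ sum (f ∘ suc) + g (suc i)
  tails = sum-update i (λ x x≢i → agree (suc x) (x≢i ∘ Finₚ.suc-injective))

sum-update₂ : ∀ {k} {f g : Fin k → ℕ} {i j : Fin k} → i ≢ j →
  (∀ x → x ≢ i → x ≢ j → g x ≡ f x) → g i + g j < f i + f j → sum g < sum f
sum-update₂ {f = f} {g} {i} {j} i≢j agree drop =
  +-cancelʳ-< (f i + f j) (sum g) (sum f)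
    (subst (_< sum f + (f i + f j)) (sym total) (+-monoʳ-< (sum f) drop))
  where
  h : Fin _ → ℕ
  h = updateAt f i (const (g i))
  h-off-i : ∀ x → x ≢ i → h x ≡ f x
  h-off-i x x≢i = updateAt-minimal x i f x≢i
  g-off-j : ∀ x → x ≢ j → g x ≡ h x
  g-off-j x x≢j with x Fin.≟ i
  ... | yes refl = sym (updateAt-updates i f)
  ... | no  x≢i  = trans (agree x x≢i x≢j) (sym (h-off-i x x≢i))
  open ≡-Reasoning
  total : sum g + (f i + f j) ≡ sum f + (g i + g j)
  total = begin
    sum g + (f i + f j)    ≡⟨ rotate (sum g) (f i) (f j) ⟩
    sum g + f j + f i      ≡⟨ cong (λ z → sum g + z + f i) (h-off-i j (i≢j ∘ sym)) ⟨
    sum g + h j + f i      ≡⟨ cong (_+ f i) (sum-update j g-off-j) ⟩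
    sum h + g j + f i      ≡⟨ rotate′ (sum h) (g j) (f i) ⟩
    sum h + f i + g j      ≡⟨ cong (_+ g j) (sum-update i h-off-i) ⟩
    sum f + h i + g j      ≡⟨ cong (λ z → sum f + z + g j) (updateAt-updates i f) ⟩
    sum f + g i + g j      ≡⟨ +-assoc (sum f) (g i) (g j) ⟩
    sum f + (g i + g j)    ∎
    where
    rotate : ∀ a b c → a + (b + c) ≡ a + c + b
    rotate = solve-∀
    rotate′ : ∀ a b c → a + b + c ≡ a + c + b
    rotate′ = solve-∀

record OneIn (f : ℕ → Bool) (lo hi : ℕ) : Set where
  field
    point    : ℕ
    lo≤point : lo ≤ point
    point≤hi : point ≤ hi
    holds    : f point ≡ true
    unique   : ∀ {y} → lo ≤ y → y ≤ hi → f y ≡ true → y ≡ point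

  vanishes : ∀ {y} → lo ≤ y → y ≤ hi → y ≢ point → f y ≡ false
  vanishes lo≤y y≤hi y≢point = ¬-not (y≢point ∘ unique lo≤y y≤hi)

subst-OneIn : ∀ {f g lo hi} → f ≡ g → OneIn f lo hi → OneIn g lo hi
subst-OneIn {lo = lo} {hi} = subst (λ h → OneIn h lo hi)

Singleton : ∀ {n} → Subset n → Set
Singleton {n} p = Σ (Fin n) λ x → lookup p x ≡ true × (∀ y → lookup p y ≡ true → y ≡ x)

∣p∣≡0⇒empty : ∀ {n} (p : Subset n) → ∣ p ∣ ≡ 0 → ∀ y → lookup p y ≢ true
∣p∣≡0⇒empty (outside ∷ p) ∣p∣≡0 zero    = λ ()
∣p∣≡0⇒empty (outside ∷ p) ∣p∣≡0 (suc y) = ∣p∣≡0⇒empty p ∣p∣≡0 y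

empty⇒∣p∣≡0 : ∀ {n} (p : Subset n) → (∀ y → lookup p y ≢ true) → ∣ p ∣ ≡ 0
empty⇒∣p∣≡0 []            _     = refl
empty⇒∣p∣≡0 (inside ∷ p)  empty = contradiction refl (empty zero)
empty⇒∣p∣≡0 (outside ∷ p) empty = empty⇒∣p∣≡0 p (empty ∘ suc)

∣p∣≡1⇒singleton : ∀ {n} (p : Subset n) → ∣ p ∣ ≡ 1 → Singleton p
∣p∣≡1⇒singleton (inside ∷ p) ∣p∣≡1 = zero , refl , only-zero
  where
  only-zero : ∀ y → lookup (inside ∷ p) y ≡ true → y ≡ zero
  only-zero zero    _  = refl
  only-zero (suc y) py = contradiction py (∣p∣≡0⇒empty p (suc-injective ∣p∣≡1) y)
∣p∣≡1⇒singleton (outside ∷ p) ∣p∣≡1 with ∣p∣≡1⇒singleton p ∣p∣≡1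
... | x , px , unique = suc x , px , λ { zero () ; (suc y) py → cong suc (unique y py) }

singleton⇒∣p∣≡1 : ∀ {n} (p : Subset n) → Singleton p → ∣ p ∣ ≡ 1
singleton⇒∣p∣≡1 (inside ∷ p)  (zero , _ , unique) =
  cong suc (empty⇒∣p∣≡0 p λ y py → contradiction (unique (suc y) py) λ ())
singleton⇒∣p∣≡1 (inside ∷ p)  (suc x , _ , unique) with () ← unique zero refl
singleton⇒∣p∣≡1 (outside ∷ p) (suc x , px , unique) =
  singleton⇒∣p∣≡1 p (x , px , λ y py → Finₚ.suc-injective (unique (suc y) py))

toSubset-sound : ∀ {n} (I : Interval n) {v} → lookup (toSubset I) v ≡ true →
  Interval.lo I Fin.≤ v × v Fin.≤ Interval.hi I
toSubset-sound I {v} v∈I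
  with Interval.lo I ≤? v | v ≤? Interval.hi I
     | trans (sym (lookup∘tabulate (λ x → ⌊ Interval.lo I ≤? x ⌋ ∧ ⌊ x ≤? Interval.hi I ⌋) v)) v∈I
... | yes lo≤v | yes v≤hi | _ = lo≤v , v≤hi
... | no _     | _        | ()
... | yes _    | no _     | ()

toSubset-complete : ∀ {n} (I : Interval n) {v} → Interval.lo I Fin.≤ v → v Fin.≤ Interval.hi I →
  lookup (toSubset I) v ≡ true
toSubset-complete I {v} lo≤v v≤hi =
  trans (lookup∘tabulate (λ x → ⌊ Interval.lo I ≤? x ⌋ ∧ ⌊ x ≤? Interval.hi I ⌋) v)
        (cong₂ _∧_ (⌊⌋-true (Interval.lo I ≤? v) lo≤v) (⌊⌋-true (v ≤? Interval.hi I) v≤hi))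

vertex : ∀ {n y} (hi : Fin n) → y ≤ toℕ hi → Σ (Fin n) λ v → toℕ v ≡ y
vertex hi y≤hi = fromℕ< (≤-<-trans y≤hi (toℕ<n hi)) , toℕ-fromℕ< _

module _ {n} (T : Subset n) (g : ℕ → Bool) (represents : ∀ v → lookup T v ≡ g (toℕ v))
         (I : Interval n) where
  open Interval I

  hits⇒oneIn : hitsExactlyOnce T (toSubset I) → OneIn g (toℕ lo) (toℕ hi)
  hits⇒oneIn hit with ∣p∣≡1⇒singleton (T ∩ toSubset I) hit
  ... | x , x∈T∩I , unique = record
    { point    = toℕ x
    ; lo≤point = proj₁ (toSubset-sound I x∈I)
    ; point≤hi = proj₂ (toSubset-sound I x∈I)
    ; holds    = trans (sym (represents x)) x∈T
    ; unique   = unique′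
    }
    where
    x∈T   = proj₁ (∧-true⁻ (trans (sym (lookup-zipWith _∧_ x T (toSubset I))) x∈T∩I))
    x∈I   = proj₂ (∧-true⁻ (trans (sym (lookup-zipWith _∧_ x T (toSubset I))) x∈T∩I))
    unique′ : ∀ {y} → toℕ lo ≤ y → y ≤ toℕ hi → g y ≡ true → y ≡ toℕ x
    unique′ lo≤y y≤hi gy with vertex hi y≤hi
    ... | v , refl = cong toℕ (unique v (trans (lookup-zipWith _∧_ v T (toSubset I))
                       (cong₂ _∧_ (trans (represents v) gy) (toSubset-complete I lo≤y y≤hi))))

  oneIn⇒hits : OneIn g (toℕ lo) (toℕ hi) → hitsExactlyOnce T (toSubset I)
  oneIn⇒hits one with vertex hi (OneIn.point≤hi one)
  ... | x , refl = singleton⇒∣p∣≡1 (T ∩ toSubset I) (x , x∈T∩I , only-x)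
    where
    open OneIn one using (lo≤point; point≤hi; holds)
    x∈T∩I : lookup (T ∩ toSubset I) x ≡ true
    x∈T∩I = trans (lookup-zipWith _∧_ x T (toSubset I))
      (cong₂ _∧_ (trans (represents x) holds) (toSubset-complete I lo≤point point≤hi))
    only-x : ∀ y → lookup (T ∩ toSubset I) y ≡ true → y ≡ x
    only-x y y∈T∩I =
      let (y∈T , y∈I) = ∧-true⁻ (trans (sym (lookup-zipWith _∧_ y T (toSubset I))) y∈T∩I)
          (lo≤y , y≤hi) = toSubset-sound I y∈I
      in toℕ-injective (OneIn.unique one lo≤y y≤hi (trans (sym (represents y)) y∈T))

module RunColouring (a b : ℕ → Bool) where

  Letter : Set
  Letter = Bool × Bool

  _≟ₗ_ : DecidableEquality Letter
  _≟ₗ_ = ≡-dec Bool._≟_ Bool._≟_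

  letter : ℕ → Letter
  letter m = a m , b m

  occupied : ℕ → Bool
  occupied m = a m ∨ b m

  -- Scan state: letter and colour of the last occupied point seen so far.
  State : Set
  State = Letter × Bool

  next : State → Letter → Bool
  next (L , c) M = if does (L ≟ₗ M) then c else not c

  next-same : ∀ L c → next (L , c) L ≡ c
  next-same L c rewrite dec-true (L ≟ₗ L) refl = refl

  next-diff : ∀ {L M} c → L ≢ M → next (L , c) M ≡ not c
  next-diff {L} {M} c L≢M rewrite dec-false (L ≟ₗ M) L≢M = refl

  state : ℕ → State
  state zero    = (false , false) , false
  state (suc m) = if occupied m then (letter m , next (state m) (letter m)) else state m

  colour : ℕ → Bool
  colour m = next (state m) (letter m)

  part : Bool → ℕ → Bool
  part c m = occupied m ∧ ⌊ colour m Bool.≟ c ⌋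

  state-occupied : ∀ m → occupied m ≡ true → state (suc m) ≡ (letter m , colour m)
  state-occupied m occ rewrite occ = refl

  state-vacant : ∀ m → occupied m ≡ false → state (suc m) ≡ state m
  state-vacant m vac rewrite vac = refl

  block-invariant : (P : State → Set) (β : Letter) {p q : ℕ} →
    (∀ {m} → p ≤ m → m < q → occupied m ≡ true → letter m ≡ β) →
    (∀ {s} → P s → P (β , next s β)) → P (state p) → p ≤′ q → P (state q)
  block-invariant P β block stable Pp ≤′-refl = Pp
  block-invariant P β {p} block stable Pp (≤′-step {m} p≤′m) = read (occupied m) refl
    where
    Pm : P (state m)
    Pm = block-invariant P β (λ p≤i i<m → block p≤i (m<n⇒m<1+n i<m)) stable Pp p≤′m
    read : ∀ u → occupied m ≡ u → P (state (suc m))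
    read true occ = subst P (sym (state-occupied m occ))
      (subst (λ L → P (L , next (state m) L)) (sym (block (≤′⇒≤ p≤′m) ≤-refl occ)) (stable Pm))
    read false vac = subst P (sym (state-vacant m vac)) Pm

  module Isolated {lo hi x : ℕ} {β : Letter} (lo≤x : lo ≤ x) (x≤hi : x ≤ hi)
    (occ-x : occupied x ≡ true) (x≢β : letter x ≢ β)
    (others : ∀ {m} → lo ≤ m → m ≤ hi → occupied m ≡ true → m ≢ x → letter m ≡ β) where

    -- Between an earlier occupied point y and x the state stays (β, colour y),
    -- so x flips the colour.
    before : ∀ {y} → lo ≤ y → y < x → occupied y ≡ true → colour x ≡ not (colour y)
    before {y} lo≤y y<x occ-y =
      trans (cong (λ s → next s (letter x)) state-x) (next-diff (colour y) (x≢β ∘ sym))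
      where
      letter-y : letter y ≡ β
      letter-y = others lo≤y (≤-trans (<⇒≤ y<x) x≤hi) occ-y (<⇒≢ y<x)
      state-x : state x ≡ (β , colour y)
      state-x = block-invariant (_≡ (β , colour y)) β
        (λ y<m m<x occ → others (≤-trans lo≤y (<⇒≤ y<m)) (≤-trans (<⇒≤ m<x) x≤hi) occ (<⇒≢ m<x))
        (λ { refl → cong (β ,_) (next-same β (colour y)) })
        (trans (state-occupied y occ-y) (cong (_, colour y) letter-y))
        (≤⇒≤′ y<x)

    -- After x the state is either (letter x, colour x) or (β, not colour x); reading β
    -- in either gives the colour opposite to x's.
    after : ∀ {y} → x < y → y ≤ hi → occupied y ≡ true → colour y ≡ not (colour x)
    after {y} x<y y≤hi occ-y =
      trans (cong (next (state y)) letter-y) (reads-β state-y)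
      where
      Past : State → Set
      Past s = s ≡ (letter x , colour x) ⊎ s ≡ (β , not (colour x))
      reads-β : ∀ {s} → Past s → next s β ≡ not (colour x)
      reads-β (inj₁ refl) = next-diff (colour x) x≢β
      reads-β (inj₂ refl) = next-same β (not (colour x))
      letter-y : letter y ≡ β
      letter-y = others (≤-trans lo≤x (<⇒≤ x<y)) y≤hi occ-y (<⇒≢ x<y ∘ sym)
      state-y : Past (state y)
      state-y = block-invariant Past β
        (λ x<m m<y occ → others (≤-trans lo≤x (<⇒≤ x<m)) (≤-trans (<⇒≤ m<y) y≤hi) occ (<⇒≢ x<m ∘ sym))
        (λ past → inj₂ (cong (β ,_) (reads-β past)))
        (inj₁ (state-occupied x occ-x))
        (≤⇒≤′ x<y)

    isolated : OneIn (part (colour x)) lo hi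
    isolated = record
      { point    = x
      ; lo≤point = lo≤x
      ; point≤hi = x≤hi
      ; holds    = cong₂ _∧_ occ-x (⌊⌋-true (colour x Bool.≟ colour x) refl)
      ; unique   = only-x
      }
      where
      only-x : ∀ {y} → lo ≤ y → y ≤ hi → part (colour x) y ≡ true → y ≡ x
      only-x {y} lo≤y y≤hi y∈part = by-position (<-cmp y x)
        where
        occ-y : occupied y ≡ true
        occ-y = proj₁ (∧-true⁻ y∈part)
        same-colour : colour y ≡ colour x
        same-colour = ⌊⌋-true⁻ (colour y Bool.≟ colour x) (proj₂ (∧-true⁻ y∈part))
        by-position : Tri (y < x) (y ≡ x) (x < y) → y ≡ x
        by-position (tri< y<x _ _) =
          contradiction (trans (before lo≤y y<x occ-y) (cong not same-colour)) (not-¬ refl)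
        by-position (tri≈ _ y≡x _) = y≡x
        by-position (tri> _ _ x<y) =
          contradiction (trans (sym same-colour) (after x<y y≤hi occ-y)) (not-¬ refl)

  -- Replacing a, b by the colour classes keeps every interval exactly hit: if a meets
  -- [lo, hi] only at x, every other occupied point there lies in b only (letter
  -- (false, true)), and symmetrically for b.
  merge : ∀ {lo hi} → OneIn a lo hi ⊎ OneIn b lo hi → Σ Bool λ c → OneIn (part c) lo hi
  merge (inj₁ one-a) = colour point , Isolated.isolated lo≤point point≤hi occ-x x≢β b-only
    where
    open OneIn one-a
    occ-x : occupied point ≡ true
    occ-x = cong (_∨ b point) holds
    x≢β : letter point ≢ (false , true)
    x≢β eq = contradiction (trans (sym holds) (cong proj₁ eq)) λ ()
    b-only : ∀ {m} → _ ≤ m → m ≤ _ → occupied m ≡ true → m ≢ point → letter m ≡ (false , true)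
    b-only {m} lo≤m m≤hi occ m≢x = cong₂ _,_ a-m (trans (sym (cong (_∨ b m) a-m)) occ)
      where
      a-m : a m ≡ false
      a-m = vanishes lo≤m m≤hi m≢x
  merge (inj₂ one-b) = colour point , Isolated.isolated lo≤point point≤hi occ-x x≢β a-only
    where
    open OneIn one-b
    occ-x : occupied point ≡ true
    occ-x = trans (cong (a point ∨_) holds) (∨-zeroʳ (a point))
    x≢β : letter point ≢ (true , false)
    x≢β eq = contradiction (trans (sym holds) (cong proj₂ eq)) λ ()
    a-only : ∀ {m} → _ ≤ m → m ≤ _ → occupied m ≡ true → m ≢ point → letter m ≡ (true , false)
    a-only {m} lo≤m m≤hi occ m≢x =
      cong₂ _,_ (trans (sym (∨-identityʳ (a m))) (trans (cong (a m ∨_) (sym b-m)) occ)) b-m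
      where
      b-m : b m ≡ false
      b-m = vanishes lo≤m m≤hi m≢x

  parts-count : ∀ m → 𝟙 (part false m) + 𝟙 (part true m) ≡ 𝟙 (occupied m)
  parts-count m = split (occupied m) (colour m)
    where
    split : ∀ u c → 𝟙 (u ∧ ⌊ c Bool.≟ false ⌋) + 𝟙 (u ∧ ⌊ c Bool.≟ true ⌋) ≡ 𝟙 u
    split false _     = refl
    split true  false = refl
    split true  true  = refl

  parts-≤ : ∀ m → 𝟙 (part false m) + 𝟙 (part true m) ≤ 𝟙 (a m) + 𝟙 (b m)
  parts-≤ m = subst (_≤ 𝟙 (a m) + 𝟙 (b m)) (sym (parts-count m)) (𝟙-∨ (a m) (b m))

  parts-< : ∀ m → a m ≡ true → b m ≡ true →
    𝟙 (part false m) + 𝟙 (part true m) < 𝟙 (a m) + 𝟙 (b m)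
  parts-< m a-m b-m rewrite parts-count m | a-m | b-m = s≤s (s≤s z≤n)

module Disjointify (n : ℕ) {k len : ℕ} (lo hi : Fin len → ℕ) where

  Family : Set
  Family = Fin k → ℕ → Bool

  Covers : Family → (Fin len → Fin k) → Set
  Covers τ q = ∀ i → OneIn (τ (q i)) (lo i) (hi i)

  Disjoint : Family → Set
  Disjoint τ = ∀ {c d} (v : Fin n) → τ c (toℕ v) ≡ true → τ d (toℕ v) ≡ true → c ≡ d

  Overlap : Family → Set
  Overlap τ = Σ (Fin k) λ c → Σ (Fin k) λ d → c ≢ d ×
    Σ (Fin n) λ v → τ c (toℕ v) ≡ true × τ d (toℕ v) ≡ true

  overlap? : ∀ τ → Dec (Overlap τ)
  overlap? τ = any? λ c → any? λ d → ¬? (c Fin.≟ d) ×-dec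
    any? λ v → (τ c (toℕ v) Bool.≟ true) ×-dec (τ d (toℕ v) Bool.≟ true)

  ¬overlap⇒disjoint : ∀ τ → ¬ Overlap τ → Disjoint τ
  ¬overlap⇒disjoint τ none {c} {d} v τc τd with c Fin.≟ d
  ... | yes c≡d = c≡d
  ... | no  c≢d = contradiction (c , d , c≢d , v , τc , τd) none

  size : (ℕ → Bool) → ℕ
  size f = sum λ (v : Fin n) → 𝟙 (f (toℕ v))

  size-+ : ∀ f g → sum (λ (v : Fin n) → 𝟙 (f (toℕ v)) + 𝟙 (g (toℕ v))) ≡ size f + size g
  size-+ f g = ∑-distrib-+ {n} (λ v → 𝟙 (f (toℕ v))) (λ v → 𝟙 (g (toℕ v)))

  weight : Family → ℕ
  weight τ = sum λ c → size (τ c)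

  module MergeStep {τ q} (covers : Covers τ q) {c d} (c≢d : c ≢ d)
                   (v : Fin n) (τc : τ c (toℕ v) ≡ true) (τd : τ d (toℕ v) ≡ true) where
    open RunColouring (τ c) (τ d) using (part; merge; parts-≤; parts-<)

    slot : Bool → Fin k
    slot false = c
    slot true  = d

    τ′ : Family
    τ′ = updateAt (updateAt τ c (const (part false))) d (const (part true))

    τ′-slot : ∀ b → τ′ (slot b) ≡ part b
    τ′-slot false = trans (updateAt-minimal c d _ c≢d) (updateAt-updates c τ)
    τ′-slot true  = updateAt-updates d _

    τ′-other : ∀ {e} → e ≢ c → e ≢ d → τ′ e ≡ τ e
    τ′-other {e} e≢c e≢d = trans (updateAt-minimal e d _ e≢d) (updateAt-minimal e c τ e≢c)

    via-merge : ∀ {l h} → OneIn (τ c) l h ⊎ OneIn (τ d) l h → Σ (Fin k) λ e → OneIn (τ′ e) l h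
    via-merge hit with merge hit
    ... | b , one = slot b , subst-OneIn (sym (τ′-slot b)) one

    reassign : ∀ i → Σ (Fin k) λ e → OneIn (τ′ e) (lo i) (hi i)
    reassign i with q i Fin.≟ c | q i Fin.≟ d
    ... | yes qi≡c | _        = via-merge (inj₁ (subst-OneIn (cong τ qi≡c) (covers i)))
    ... | no  _    | yes qi≡d = via-merge (inj₂ (subst-OneIn (cong τ qi≡d) (covers i)))
    ... | no  qi≢c | no  qi≢d = q i , subst-OneIn (sym (τ′-other qi≢c qi≢d)) (covers i)

    q′ : Fin len → Fin k
    q′ i = proj₁ (reassign i)

    covers′ : Covers τ′ q′
    covers′ i = proj₂ (reassign i)

    merged-smaller : size (part false) + size (part true) < size (τ c) + size (τ d)
    merged-smaller = subst₂ _<_ (size-+ (part false) (part true)) (size-+ (τ c) (τ d))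
      (sum-mono-< (λ u → parts-≤ (toℕ u)) v (parts-< (toℕ v) τc τd))

    lighter : weight τ′ < weight τ
    lighter = sum-update₂ c≢d (λ e e≢c e≢d → cong size (τ′-other e≢c e≢d))
      (subst₂ (λ f g → size f + size g < size (τ c) + size (τ d))
              (sym (τ′-slot false)) (sym (τ′-slot true)) merged-smaller)

  record DisjointCover : Set where
    field
      family   : Family
      assign   : Fin len → Fin k
      covers   : Covers family assign
      disjoint : Disjoint family

  disjointify : ∀ τ q → Covers τ q → Acc _<_ (weight τ) → DisjointCover
  disjointify τ q covers (acc smaller) with overlap? τ
  ... | no none = record { family = τ ; assign = q ; covers = covers
                         ; disjoint = ¬overlap⇒disjoint τ none }
  ... | yes (c , d , c≢d , v , τc , τd) = disjointify τ′ q′ covers′ (smaller lighter)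
    where open MergeStep {τ} {q} covers c≢d v τc τd

  colouring : Family → Fin n → Fin (suc k)
  colouring τ v with any? (λ c → τ c (toℕ v) Bool.≟ true)
  ... | yes (c , _) = suc c
  ... | no  _       = zero

  colourClass-colouring : ∀ {τ} → Disjoint τ → ∀ c v →
    lookup (colourClass (colouring τ) (suc c)) v ≡ τ c (toℕ v)
  colourClass-colouring {τ} disjoint c v =
    trans (lookup∘tabulate (λ u → ⌊ colouring τ u Fin.≟ suc c ⌋) v) class-of
    where
    class-of : ⌊ colouring τ v Fin.≟ suc c ⌋ ≡ τ c (toℕ v)
    class-of with any? (λ e → τ e (toℕ v) Bool.≟ true) | τ c (toℕ v) in τc
    ... | yes (e , τe) | true  = ⌊⌋-true (suc e Fin.≟ suc c) (cong suc (disjoint v τe τc))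
    ... | yes (e , τe) | false = ⌊⌋-false (suc e Fin.≟ suc c) λ e≡c →
          contradiction (trans (sym τc) (subst (λ f → τ f (toℕ v) ≡ true) (Finₚ.suc-injective e≡c) τe)) λ ()
    ... | no  none     | true  = contradiction (c , τc) none
    ... | no  _        | false = refl

extend : ∀ {n} → (Fin n → Bool) → ℕ → Bool
extend {n} f m with m <? n
... | yes m<n = f (fromℕ< m<n)
... | no  _   = false

extend-toℕ : ∀ {n} (f : Fin n → Bool) (v : Fin n) → extend f (toℕ v) ≡ f v
extend-toℕ {n} f v with toℕ v <? n
... | yes v<n = cong f (fromℕ<-toℕ v v<n)
... | no  v≮n = contradiction (toℕ<n v) v≮n

conflictFree⇒partition : ∀ {n} (𝓘 : List (Interval n)) k →
  ∃[ C ] ConflictFree 𝓘 k C → PartitionIntoExactlyHittable 𝓘 k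
conflictFree⇒partition 𝓘 k (C , conflictFree) =
  (λ i → proj₁ (conflictFree i)) ,
  λ j → colourClass C (suc j) , λ i ji≡j →
    subst (λ j′ → hitsExactlyOnce (colourClass C (suc j′)) (toSubset (List.lookup 𝓘 i)))
          ji≡j (proj₂ (conflictFree i))

partition⇒conflictFree : ∀ {n} (𝓘 : List (Interval n)) k →
  PartitionIntoExactlyHittable 𝓘 k → ∃[ C ] ConflictFree 𝓘 k C
partition⇒conflictFree {n} 𝓘 k (part , hitting) =
  colouring family ,
  λ i → assign i ,
    oneIn⇒hits (colourClass (colouring family) (suc (assign i))) (family (assign i))
      (colourClass-colouring {family} disjoint (assign i)) (List.lookup 𝓘 i) (covers i)
  where
  lo hi : Fin (length 𝓘) → ℕ
  lo i = toℕ (Interval.lo (List.lookup 𝓘 i))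
  hi i = toℕ (Interval.hi (List.lookup 𝓘 i))
  open Disjointify n {k} lo hi

  τ₀ : Family
  τ₀ c = extend (lookup (proj₁ (hitting c)))

  covers₀ : Covers τ₀ part
  covers₀ i = hits⇒oneIn (proj₁ (hitting (part i))) (τ₀ (part i)) (λ v → sym (extend-toℕ _ v))
                         (List.lookup 𝓘 i)
                         (proj₂ (hitting (part i)) i refl)

  open DisjointCover (disjointify τ₀ part covers₀ (<-wellFounded (weight τ₀)))

theorem4 : (n : ℕ) → n ≥ 1 → (𝓘 : List (Interval n)) → Unique 𝓘 →
    (k : ℕ) → k ≥ 1 →
    (PartitionIntoExactlyHittable 𝓘 k → ∃[ C ] ConflictFree 𝓘 k C)
    × ((∃[ C ] ConflictFree 𝓘 k C) → PartitionIntoExactlyHittable 𝓘 k)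
theorem4 n _ 𝓘 _ k _ = partition⇒conflictFree 𝓘 k , conflictFree⇒partition 𝓘 k
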